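{- Let $\mathcal{M}_1 = (V,\mathcal{I}_1)$ and $\mathcal{M}_2 = (V,\mathcal{I}_2)$ be matroids on the same ground set $V$ with $|V|=n$, accessible through rank oracles. Given a common independent set $S \in \mathcal{I}_1 \cap \mathcal{I}_2$, using $O(n)$ rank oracle queries one can find the distance layers $D_1 \subseteq V \setminus S$, $D_2 \subseteq S$, and $D_3 \subseteq V \setminus S$ of the exchange graph $G(S)$.
   Context: For $S \in \mathcal{I}_1\cap\mathcal{I}_2$, the exchange graph $G(S)$ is the directed graph on vertex set $V \cup \{s,t\}$ (with $s,t\notin V$) whose arcs are: $(u,v)$ for $u\in S$, $v\in V\setminus S$ with $S-u+v\in\mathcal{I}_1$; $(v,u)$ for $u\in S$, $v\in V\setminus S$ with $S-u+v\in\mathcal{I}_2$; $(s,v)$ for $v\in V\setminus S$ with $S+v\in\mathcal{I}_1$; and $(v,t)$ for $v\in V\setminus S$ with $S+v\in\mathcal{I}_2$. Here $S+v = S\cup\{v\}$, $S-u=S\setminus\{u\}$. For each $i$, $D_i$ is the set of elements $v\in V$ whose (directed) distance from $s$ in $G(S)$ is exactly $i$. A rank oracle for $\mathcal{M}_j$ takes $X\subseteq V$ and returns $\mathrm{rank}_{\mathcal{M}_j}(X)=\max\{|T|: T\subseteq X, T\in\mathcal{I}_j\}$; each call is one query. -}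

module Defs where

open import Data.Nat using (ℕ; zero; suc; _+_; _*_; _<_; _≤_)
open import Data.Fin using (Fin)
open import Data.Fin.Subset using (Subset; ⊥; ⁅_⁆; _∈_; _∉_; _⊆_; _∪_; _-_; ∣_∣)
open import Data.Product using (Σ; ∃; _×_; _,_)
open import Relation.Nullary using (¬_)

record Matroid (n : ℕ) : Set₁ where
  field
    Indep     : Subset n → Set
    indep-⊥   : Indep ⊥
    indep-↓   : ∀ {A B} → A ⊆ B → Indep B → Indep A
    exchange  : ∀ {A B} → Indep A → Indep B → ∣ A ∣ < ∣ B ∣ →
                ∃ λ x → x ∈ B × x ∉ A × Indep (A ∪ ⁅ x ⁆)
open Matroid public

IsRank : ∀ {n} → Matroid n → Subset n → ℕ → Set
IsRank M X r =
  (∃ λ T → T ⊆ X × Indep M T × ∣ T ∣ ≡' r) × (∀ T → T ⊆ X → Indep M T → ∣ T ∣ ≤ r)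
  where
  open import Relation.Binary.PropositionalEquality renaming (_≡_ to _≡'_)

IsRankOracle : ∀ {n} → Matroid n → (Subset n → ℕ) → Set
IsRankOracle M r = ∀ X → IsRank M X (r X)

data Node (n : ℕ) : Set where
  src : Node n
  snk : Node n
  el  : Fin n → Node n

data Arc {n : ℕ} (M₁ M₂ : Matroid n) (S : Subset n) : Node n → Node n → Set where
  arc₁ : ∀ {u v} → u ∈ S → v ∉ S → Indep M₁ ((S - u) ∪ ⁅ v ⁆) → Arc M₁ M₂ S (el u) (el v)
  arc₂ : ∀ {u v} → u ∈ S → v ∉ S → Indep M₂ ((S - u) ∪ ⁅ v ⁆) → Arc M₁ M₂ S (el v) (el u)
  arcs : ∀ {v} → v ∉ S → Indep M₁ (S ∪ ⁅ v ⁆) → Arc M₁ M₂ S src (el v)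
  arct : ∀ {v} → v ∉ S → Indep M₂ (S ∪ ⁅ v ⁆) → Arc M₁ M₂ S (el v) snk

data Walk {n : ℕ} (M₁ M₂ : Matroid n) (S : Subset n) : ℕ → Node n → Node n → Set where
  here : ∀ {x} → Walk M₁ M₂ S zero x x
  step : ∀ {k x y z} → Arc M₁ M₂ S x y → Walk M₁ M₂ S k y z → Walk M₁ M₂ S (suc k) x z

InLayer : ∀ {n} → Matroid n → Matroid n → Subset n → ℕ → Fin n → Set
InLayer M₁ M₂ S i v =
  Walk M₁ M₂ S i src (el v) × (∀ j → j < i → ¬ Walk M₁ M₂ S j src (el v))

data OracleProg (n : ℕ) (A : Set) : Set where
  ret  : A → OracleProg n A
  ask₁ : Subset n → (ℕ → OracleProg n A) → OracleProg n A
  ask₂ : Subset n → (ℕ → OracleProg n A) → OracleProg n A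

run : ∀ {n A} → OracleProg n A → (Subset n → ℕ) → (Subset n → ℕ) → A
run (ret a)    r₁ r₂ = a
run (ask₁ X k) r₁ r₂ = run (k (r₁ X)) r₁ r₂
run (ask₂ X k) r₁ r₂ = run (k (r₂ X)) r₁ r₂

queries : ∀ {n A} → OracleProg n A → (Subset n → ℕ) → (Subset n → ℕ) → ℕ
queries (ret a)    r₁ r₂ = 0
queries (ask₁ X k) r₁ r₂ = suc (queries (k (r₁ X)) r₁ r₂)
queries (ask₂ X k) r₁ r₂ = suc (queries (k (r₂ X)) r₁ r₂)

Represents : ∀ {n} → Matroid n → Matroid n → Subset n → ℕ → Subset n → Set
Represents M₁ M₂ S i D = ∀ v → (v ∈ D → InLayer M₁ M₂ S i v) × (InLayer M₁ M₂ S i v → v ∈ D)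

CorrectLayers : ∀ {n} → Matroid n → Matroid n → Subset n → Subset n × Subset n × Subset n → Set
CorrectLayers M₁ M₂ S (D₁ , D₂ , D₃) =
  Represents M₁ M₂ S 1 D₁ × Represents M₁ M₂ S 2 D₂ × Represents M₁ M₂ S 3 D₃

-- Three batches of n rank queries suffice, one per layer.  D₁ consists of the
-- v ∉ S with ∣S∣ < rank₁(S + v).  D₂ consists of the u ∈ S with
-- ∣S - u∣ < rank₂((S - u) ∪ D₁): such a rank gap is witnessed by a single
-- element of D₁ that can be added to S - u.  D₃ consists of the v ∉ S ∪ D₁ with
-- S ─ D₂ + v independent in M₁: since S + v is dependent, augmenting S ─ D₂ + v
-- from S yields a set S - u + v that is independent in M₁, and the element u
-- that it misses lies in D₂.
module Submission where

open import Defs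
open import Data.Nat using (ℕ; suc; _*_; _≤_)
open import Data.Fin.Subset using (Subset)
open import Data.Product using (Σ; _×_; _,_)

open import Data.Bool.Properties using (T-≡)
open import Data.Empty using (⊥-elim)
open import Data.Fin using (Fin; zero; suc; _≟_)
open import Data.Fin.Properties using (any?)
open import Data.Fin.Subset using (_∈_; _∉_; _⊆_; _∪_; _─_; _-_; ⁅_⁆; ∣_∣; inside; outside)
open import Data.Fin.Subset.Properties
open import Data.Nat using (zero; _+_; _<_; z≤n; s≤s; _<?_)
open import Data.Nat.Properties
  using (≤-antisym; ≤-reflexive; ≤-pred; <⇒≱; ≤∧≢⇒<; m<m+n; +-identityʳ; +-suc; n≤1+n; *-monoʳ-≤; m≤n⇒∃[o]m+o≡n)
open import Data.Product using (∃; proj₁; proj₂)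
open import Data.Sum using (inj₁; inj₂)
open import Data.Vec using (_∷_; []; tabulate; here; there)
open import Data.Vec.Properties using ([]=⇒lookup; lookup⇒[]=; lookup∘tabulate)
open import Function using (_∘_)
open import Function.Bundles using (_⇔_; mk⇔; Equivalence)
open import Relation.Binary.PropositionalEquality using (_≡_; refl; sym; trans; cong; subst)
open import Relation.Nullary using (¬_; Dec; yes; no)
open import Relation.Nullary.Decidable using (isYes; toWitness; fromWitness; ¬?; _×-dec_)

open Equivalence using (to; from)

private
  variable
    n m : ℕ
    p q r : Subset n
    x y : Fin n

∪-lub : p ⊆ r → q ⊆ r → p ∪ q ⊆ r
∪-lub {p = p} {q = q} p⊆r q⊆r x∈p∪q with x∈p∪q⁻ p q x∈p∪q
... | inj₁ x∈p = p⊆r x∈p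
... | inj₂ x∈q = q⊆r x∈q

∪-monoˡ-⊆ : p ⊆ q → p ∪ r ⊆ q ∪ r
∪-monoˡ-⊆ {q = q} {r = r} p⊆q = ∪-lub (⊆-trans p⊆q (p⊆p∪q r)) (q⊆p∪q q r)

∪-monoʳ-⊆ : q ⊆ r → p ∪ q ⊆ p ∪ r
∪-monoʳ-⊆ {r = r} {p = p} q⊆r = ∪-lub (p⊆p∪q r) (⊆-trans q⊆r (q⊆p∪q p r))

x∈p∪q∧x∉p⇒x∈q : ∀ (p q : Subset n) → x ∈ p ∪ q → x ∉ p → x ∈ q
x∈p∪q∧x∉p⇒x∈q p q x∈p∪q x∉p with x∈p∪q⁻ p q x∈p∪q
... | inj₁ x∈p = ⊥-elim (x∉p x∈p)
... | inj₂ x∈q = x∈q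

x∈p⇒⁅x⁆⊆p : x ∈ p → ⁅ x ⁆ ⊆ p
x∈p⇒⁅x⁆⊆p {x = x} {p = p} x∈p y∈⁅x⁆ = subst (_∈ p) (sym (x∈⁅y⁆⇒x≡y x y∈⁅x⁆)) x∈p

x∈p─q⇒x∉q : ∀ (p q : Subset n) → x ∈ p ─ q → x ∉ q
x∈p─q⇒x∉q (_ ∷ p) (outside ∷ q) here        ()
x∈p─q⇒x∉q (_ ∷ p) (_       ∷ q) (there x∈) (there x∈q) = x∈p─q⇒x∉q p q x∈ x∈q

x∈p∧x∉p─q⇒x∈q : x ∈ p → x ∉ p ─ q → x ∈ q
x∈p∧x∉p─q⇒x∈q {x = x} {q = q} x∈p x∉p─q with x ∈? q
... | yes x∈q = x∈q
... | no  x∉q = ⊥-elim (x∉p─q (x∈p∧x∉q⇒x∈p─q x∈p x∉q))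

x∈q⇒p─q⊆p-x : ∀ (p : Subset n) → x ∈ q → p ─ q ⊆ p - x
x∈q⇒p─q⊆p-x {q = q} p x∈q {y} y∈p─q =
  x∈p∧x≢y⇒x∈p-y (p─q⊆p p q y∈p─q) λ { refl → x∈p─q⇒x∉q p q y∈p─q x∈q }

p⊆q∪r∧x∉p⇒p⊆q-x∪r : ∀ (q r : Subset n) → p ⊆ q ∪ r → x ∉ p → p ⊆ (q - x) ∪ r
p⊆q∪r∧x∉p⇒p⊆q-x∪r q r p⊆q∪r x∉p {y} y∈p with x∈p∪q⁻ q r (p⊆q∪r y∈p)
... | inj₁ y∈q = x∈p∪q⁺ (inj₁ (x∈p∧x≢y⇒x∈p-y y∈q λ { refl → x∉p y∈p }))
... | inj₂ y∈r = x∈p∪q⁺ (inj₂ y∈r)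

x∉p⇒∣p∪⁅x⁆∣≡1+∣p∣ : x ∉ p → ∣ p ∪ ⁅ x ⁆ ∣ ≡ suc ∣ p ∣
x∉p⇒∣p∪⁅x⁆∣≡1+∣p∣ {x = zero}  {p = outside ∷ p} _   = cong (suc ∘ ∣_∣) (∪-identityʳ p)
x∉p⇒∣p∪⁅x⁆∣≡1+∣p∣ {x = zero}  {p = inside  ∷ p} x∉p = ⊥-elim (x∉p here)
x∉p⇒∣p∪⁅x⁆∣≡1+∣p∣ {x = suc x} {p = outside ∷ p} x∉p = x∉p⇒∣p∪⁅x⁆∣≡1+∣p∣ (x∉p ∘ there)
x∉p⇒∣p∪⁅x⁆∣≡1+∣p∣ {x = suc x} {p = inside  ∷ p} x∉p = cong suc (x∉p⇒∣p∪⁅x⁆∣≡1+∣p∣ (x∉p ∘ there))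

p⊆q∧∣q∣≤∣p∣⇒q⊆p : p ⊆ q → ∣ q ∣ ≤ ∣ p ∣ → q ⊆ p
p⊆q∧∣q∣≤∣p∣⇒q⊆p {p = p} p⊆q ∣q∣≤∣p∣ {x} x∈q with x ∈? p
... | yes x∈p = x∈p
... | no  x∉p = ⊥-elim (<⇒≱ (p⊂q⇒∣p∣<∣q∣ (p⊆q , x , x∈q , x∉p)) ∣q∣≤∣p∣)

∣p∣<∣q∣⇒x∈q∧x∉p : ∣ p ∣ < ∣ q ∣ → ∃ λ x → x ∈ q × x ∉ p
∣p∣<∣q∣⇒x∈q∧x∉p {p = p} {q = q} ∣p∣<∣q∣ with any? (λ x → (x ∈? q) ×-dec ¬? (x ∈? p))
... | yes witness = witness
... | no  none    = ⊥-elim (<⇒≱ ∣p∣<∣q∣ (p⊆q⇒∣p∣≤∣q∣ q⊆p))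
  where
  q⊆p : q ⊆ p
  q⊆p {x} x∈q with x ∈? p
  ... | yes x∈p = x∈p
  ... | no  x∉p = ⊥-elim (none (x , x∈q , x∉p))

x∈p⇒1+∣p-x∣≡∣p∣ : x ∈ p → suc ∣ p - x ∣ ≡ ∣ p ∣
x∈p⇒1+∣p-x∣≡∣p∣ {x = x} {p = p} x∈p = ≤-antisym (x∈p⇒∣p-x∣<∣p∣ x∈p) ∣p∣≤1+∣p-x∣
  where
  p⊆p-x∪⁅x⁆ : p ⊆ (p - x) ∪ ⁅ x ⁆
  p⊆p-x∪⁅x⁆ {y} y∈p with y ≟ x
  ... | yes refl = x∈p∪q⁺ (inj₂ (x∈⁅x⁆ x))
  ... | no  y≢x  = x∈p∪q⁺ (inj₁ (x∈p∧x≢y⇒x∈p-y y∈p y≢x))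

  ∣p∣≤1+∣p-x∣ : ∣ p ∣ ≤ suc ∣ p - x ∣
  ∣p∣≤1+∣p-x∣ = subst (∣ p ∣ ≤_) (x∉p⇒∣p∪⁅x⁆∣≡1+∣p∣ (λ x∈p-x → x∈p─q⇒x∉q p ⁅ x ⁆ x∈p-x (x∈⁅x⁆ x)))
                  (p⊆q⇒∣p∣≤∣q∣ p⊆p-x∪⁅x⁆)

∈-tabulate-isYes⇔ : ∀ {P : Fin n → Set} (P? : ∀ i → Dec (P i)) {i} → i ∈ tabulate (λ j → isYes (P? j)) ⇔ P i
∈-tabulate-isYes⇔ P? {i} = mk⇔
  (λ i∈ → toWitness (from T-≡ (trans (sym (lookup∘tabulate _ i)) ([]=⇒lookup i∈))))
  (λ Pi → lookup⇒[]= i _ (trans (lookup∘tabulate _ i) (to T-≡ (fromWitness Pi))))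

∣p-x∪⁅y⁆∣≡∣p∣ : x ∈ p → y ∉ p → ∣ (p - x) ∪ ⁅ y ⁆ ∣ ≡ ∣ p ∣
∣p-x∪⁅y⁆∣≡∣p∣ {p = p} x∈p y∉p =
  trans (x∉p⇒∣p∪⁅x⁆∣≡1+∣p∣ (y∉p ∘ p─q⊆p p _)) (x∈p⇒1+∣p-x∣≡∣p∣ x∈p)

A⊆S∪⁅v⁆∧∣A∣≡∣S∣⇒S-u∪⁅v⁆⊆A : ∀ {S A : Subset n} {v} → v ∉ S → A ⊆ S ∪ ⁅ v ⁆ → v ∈ A → ∣ A ∣ ≡ ∣ S ∣ →
                   ∃ λ u → u ∈ S × u ∉ A × (S - u) ∪ ⁅ v ⁆ ⊆ A
A⊆S∪⁅v⁆∧∣A∣≡∣S∣⇒S-u∪⁅v⁆⊆A {S = S} {A} {v} v∉S A⊆S+v v∈A ∣A∣≡∣S∣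
  with ∣p∣<∣q∣⇒x∈q∧x∉p (subst (∣ A ∣ <_) (sym (x∉p⇒∣p∪⁅x⁆∣≡1+∣p∣ v∉S)) (s≤s (≤-reflexive ∣A∣≡∣S∣)))
... | u , u∈S+v , u∉A = u , u∈S , u∉A , p⊆q∧∣q∣≤∣p∣⇒q⊆p A⊆S-u+v (≤-reflexive ∣S-u+v∣≡∣A∣)
  where
  u∈S : u ∈ S
  u∈S with x∈p∪q⁻ S ⁅ v ⁆ u∈S+v
  ... | inj₁ u∈S   = u∈S
  ... | inj₂ u∈⁅v⁆ = ⊥-elim (u∉A (x∈p⇒⁅x⁆⊆p v∈A u∈⁅v⁆))

  A⊆S-u+v : A ⊆ (S - u) ∪ ⁅ v ⁆
  A⊆S-u+v = p⊆q∪r∧x∉p⇒p⊆q-x∪r S ⁅ v ⁆ A⊆S+v u∉A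

  ∣S-u+v∣≡∣A∣ : ∣ (S - u) ∪ ⁅ v ⁆ ∣ ≡ ∣ A ∣
  ∣S-u+v∣≡∣A∣ = trans (∣p-x∪⁅y⁆∣≡∣p∣ u∈S v∉S) (sym ∣A∣≡∣S∣)

module _ (M : Matroid n) where

  indep⊆dep⇒∣p∣<∣q∣ : p ⊆ q → Indep M p → ¬ Indep M q → ∣ p ∣ < ∣ q ∣
  indep⊆dep⇒∣p∣<∣q∣ p⊆q p∈I q∉I = ≤∧≢⇒< (p⊆q⇒∣p∣≤∣q∣ p⊆q) λ ∣p∣≡∣q∣ →
    q∉I (indep-↓ M (p⊆q∧∣q∣≤∣p∣⇒q⊆p p⊆q (≤-reflexive (sym ∣p∣≡∣q∣))) p∈I)

  augment : ∀ {A B} → Indep M A → Indep M B → ∣ A ∣ ≤ ∣ B ∣ →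
            ∃ λ A' → A ⊆ A' × A' ⊆ A ∪ B × Indep M A' × ∣ A' ∣ ≡ ∣ B ∣
  augment {A} {B} A∈I B∈I ∣A∣≤∣B∣ with m≤n⇒∃[o]m+o≡n ∣A∣≤∣B∣
  ... | k , ∣A∣+k≡∣B∣ = extend k A∈I ∣A∣+k≡∣B∣
    where
    extend : ∀ k {A} → Indep M A → ∣ A ∣ + k ≡ ∣ B ∣ →
             ∃ λ A' → A ⊆ A' × A' ⊆ A ∪ B × Indep M A' × ∣ A' ∣ ≡ ∣ B ∣
    extend zero {A} A∈I ∣A∣+0≡∣B∣ =
      A , ⊆-refl , p⊆p∪q B , A∈I , trans (sym (+-identityʳ ∣ A ∣)) ∣A∣+0≡∣B∣
    extend (suc k) {A} A∈I ∣A∣+1+k≡∣B∣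
      with exchange M A∈I B∈I (subst (∣ A ∣ <_) ∣A∣+1+k≡∣B∣ (m<m+n ∣ A ∣ (s≤s z≤n)))
    ... | x , x∈B , x∉A , A+x∈I
      with extend k A+x∈I (trans (cong (_+ k) (x∉p⇒∣p∪⁅x⁆∣≡1+∣p∣ x∉A)) (trans (sym (+-suc ∣ A ∣ k)) ∣A∣+1+k≡∣B∣))
    ... | A' , A+x⊆A' , A'⊆A+x∪B , A'∈I , ∣A'∣≡∣B∣ =
      A' , ⊆-trans (p⊆p∪q ⁅ x ⁆) A+x⊆A' ,
      ⊆-trans A'⊆A+x∪B (∪-lub (∪-monoʳ-⊆ (x∈p⇒⁅x⁆⊆p x∈B)) (q⊆p∪q A B)) , A'∈I , ∣A'∣≡∣B∣

  ∣I∣<rank⇔augmentable : ∀ {I D r} → Indep M I → IsRank M (I ∪ D) r →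
                         ∣ I ∣ < r ⇔ (∃ λ x → x ∈ D × x ∉ I × Indep M (I ∪ ⁅ x ⁆))
  ∣I∣<rank⇔augmentable {I} {D} {r} I∈I ((T , T⊆I∪D , T∈I , ∣T∣≡r) , maximal) = mk⇔ augment-from-T extend
    where
    augment-from-T : ∣ I ∣ < r → ∃ λ x → x ∈ D × x ∉ I × Indep M (I ∪ ⁅ x ⁆)
    augment-from-T ∣I∣<r with exchange M I∈I T∈I (subst (∣ I ∣ <_) (sym ∣T∣≡r) ∣I∣<r)
    ... | x , x∈T , x∉I , I+x∈I = x , x∈p∪q∧x∉p⇒x∈q I D (T⊆I∪D x∈T) x∉I , x∉I , I+x∈I

    extend : (∃ λ x → x ∈ D × x ∉ I × Indep M (I ∪ ⁅ x ⁆)) → ∣ I ∣ < r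
    extend (x , x∈D , x∉I , I+x∈I) = subst (_≤ r) (x∉p⇒∣p∪⁅x⁆∣≡1+∣p∣ x∉I)
      (maximal (I ∪ ⁅ x ⁆) (∪-monoʳ-⊆ (x∈p⇒⁅x⁆⊆p x∈D)) I+x∈I)

  ∣I∣<rank[I∪⁅x⁆]⇔indep : ∀ {I x r} → Indep M I → IsRank M (I ∪ ⁅ x ⁆) r →
                          ∣ I ∣ < r ⇔ (x ∉ I × Indep M (I ∪ ⁅ x ⁆))
  ∣I∣<rank[I∪⁅x⁆]⇔indep {I} {x} I∈I rank = mk⇔
    (the-element ∘ to (∣I∣<rank⇔augmentable I∈I rank))
    (λ (x∉I , I+x∈I) → from (∣I∣<rank⇔augmentable I∈I rank) (x , x∈⁅x⁆ x , x∉I , I+x∈I))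
    where
    the-element : (∃ λ y → y ∈ ⁅ x ⁆ × y ∉ I × Indep M (I ∪ ⁅ y ⁆)) → x ∉ I × Indep M (I ∪ ⁅ x ⁆)
    the-element (y , y∈⁅x⁆ , y-augments) with x∈⁅y⁆⇒x≡y x y∈⁅x⁆
    ... | refl = y-augments

  -- Augment A from S: the result is S - u + v for some u ∈ S outside A.
  exchange-avoiding : ∀ {S A v} → Indep M S → v ∉ S → ¬ Indep M (S ∪ ⁅ v ⁆) →
                      A ⊆ S ∪ ⁅ v ⁆ → v ∈ A → Indep M A →
                      ∃ λ u → u ∈ S × u ∉ A × Indep M ((S - u) ∪ ⁅ v ⁆)
  exchange-avoiding {S} {A} {v} S∈I v∉S S+v∉I A⊆S+v v∈A A∈I
    with augment A∈I S∈I (≤-pred (subst (∣ A ∣ <_) (x∉p⇒∣p∪⁅x⁆∣≡1+∣p∣ v∉S) (indep⊆dep⇒∣p∣<∣q∣ A⊆S+v A∈I S+v∉I)))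
  ... | A' , A⊆A' , A'⊆A∪S , A'∈I , ∣A'∣≡∣S∣
    with A⊆S∪⁅v⁆∧∣A∣≡∣S∣⇒S-u∪⁅v⁆⊆A v∉S (⊆-trans A'⊆A∪S (∪-lub A⊆S+v (p⊆p∪q ⁅ v ⁆))) (A⊆A' v∈A) ∣A'∣≡∣S∣
  ... | u , u∈S , u∉A' , S-u+v⊆A' = u , u∈S , u∉A' ∘ A⊆A' , indep-↓ M S-u+v⊆A' A'∈I

  indep[S─D∪⁅v⁆]⇔swap∈D : ∀ {S D v} → Indep M S → v ∉ S → ¬ Indep M (S ∪ ⁅ v ⁆) →
                          Indep M ((S ─ D) ∪ ⁅ v ⁆) ⇔ (∃ λ u → u ∈ D × Indep M ((S - u) ∪ ⁅ v ⁆))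
  indep[S─D∪⁅v⁆]⇔swap∈D {S} {D} {v} S∈I v∉S S+v∉I = mk⇔ swap-in-D shrink
    where
    swap-in-D : Indep M ((S ─ D) ∪ ⁅ v ⁆) → ∃ λ u → u ∈ D × Indep M ((S - u) ∪ ⁅ v ⁆)
    swap-in-D A∈I =
      let (u , u∈S , u∉A , S-u+v∈I) = exchange-avoiding {A = (S ─ D) ∪ ⁅ v ⁆} S∈I v∉S S+v∉I
                                        (∪-monoˡ-⊆ (p─q⊆p S D)) (q⊆p∪q (S ─ D) ⁅ v ⁆ (x∈⁅x⁆ v)) A∈I
      in u , x∈p∧x∉p─q⇒x∈q {q = D} u∈S (λ u∈S─D → u∉A (p⊆p∪q ⁅ v ⁆ u∈S─D)) , S-u+v∈I

    shrink : (∃ λ u → u ∈ D × Indep M ((S - u) ∪ ⁅ v ⁆)) → Indep M ((S ─ D) ∪ ⁅ v ⁆)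
    shrink (u , u∈D , S-u+v∈I) = indep-↓ M (∪-monoˡ-⊆ (x∈q⇒p─q⊆p-x S u∈D)) S-u+v∈I

module ExchangeGraph (M₁ M₂ : Matroid n) (S : Subset n) where

  snoc : ∀ {k a b c} → Walk M₁ M₂ S k a b → Arc M₁ M₂ S b c → Walk M₁ M₂ S (suc k) a c
  snoc here          e = step e here
  snoc (step e′ w) e = step e′ (snoc w e)

  no-walk₀ : ∀ {v} → ¬ Walk M₁ M₂ S 0 src (el v)
  no-walk₀ ()

  walk₁⁻ : ∀ {v} → Walk M₁ M₂ S 1 src (el v) → v ∉ S × Indep M₁ (S ∪ ⁅ v ⁆)
  walk₁⁻ (step (arcs v∉S S+v∈I₁) here) = v∉S , S+v∈I₁

  walk₂⁻ : ∀ {u} → Walk M₁ M₂ S 2 src (el u) →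
           u ∈ S × ∃ λ v → Walk M₁ M₂ S 1 src (el v) × Indep M₂ ((S - u) ∪ ⁅ v ⁆)
  walk₂⁻ (step (arcs v∉S _) (step (arc₁ v∈S _ _) here)) = ⊥-elim (v∉S v∈S)
  walk₂⁻ (step (arcs v∉S S+v∈I₁) (step (arc₂ u∈S _ S-u+v∈I₂) here)) =
    u∈S , _ , step (arcs v∉S S+v∈I₁) here , S-u+v∈I₂

  walk₃⁻ : ∀ {v} → Walk M₁ M₂ S 3 src (el v) →
           ∃ λ u → Walk M₁ M₂ S 2 src (el u) × v ∉ S × Indep M₁ ((S - u) ∪ ⁅ v ⁆)
  walk₃⁻ (step (arcs w∉S _) (step (arc₁ w∈S _ _) _)) = ⊥-elim (w∉S w∈S)
  walk₃⁻ (step s→w (step w→u@(arc₂ _ _ _) (step (arc₁ _ v∉S S-u+v∈I₁) here))) =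
    _ , step s→w (step w→u here) , v∉S , S-u+v∈I₁
  walk₃⁻ (step _ (step (arc₂ u∈S _ _) (step (arc₂ _ u∉S _) here))) = ⊥-elim (u∉S u∈S)
  walk₃⁻ (step _ (step (arct _ _) (step () here)))

  walk₁⇒layer₁ : ∀ {v} → Walk M₁ M₂ S 1 src (el v) → InLayer M₁ M₂ S 1 v
  walk₁⇒layer₁ w = w , λ { zero _ → no-walk₀ ; (suc _) (s≤s ()) }

  walk₂⇒layer₂ : ∀ {u} → Walk M₁ M₂ S 2 src (el u) → InLayer M₁ M₂ S 2 u
  walk₂⇒layer₂ w = w , λ
    { zero          _ → no-walk₀
    ; (suc zero)    _ w₁ → proj₁ (walk₁⁻ w₁) (proj₁ (walk₂⁻ w))
    ; (suc (suc _)) (s≤s (s≤s ())) }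

  layer₁⇔ : ∀ {v} → InLayer M₁ M₂ S 1 v ⇔ (v ∉ S × Indep M₁ (S ∪ ⁅ v ⁆))
  layer₁⇔ = mk⇔ (walk₁⁻ ∘ proj₁) λ (v∉S , S+v∈I₁) → walk₁⇒layer₁ (step (arcs v∉S S+v∈I₁) here)

  layer₂⇔ : ∀ {u} → InLayer M₁ M₂ S 2 u ⇔
            (u ∈ S × ∃ λ v → InLayer M₁ M₂ S 1 v × Indep M₂ ((S - u) ∪ ⁅ v ⁆))
  layer₂⇔ = mk⇔
    (λ (w , _) → let (u∈S , v , w₁ , S-u+v∈I₂) = walk₂⁻ w in u∈S , v , walk₁⇒layer₁ w₁ , S-u+v∈I₂)
    (λ (u∈S , v , (w₁ , _) , S-u+v∈I₂) →
      walk₂⇒layer₂ (snoc w₁ (arc₂ u∈S (proj₁ (walk₁⁻ w₁)) S-u+v∈I₂)))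

  layer₃⇔ : ∀ {v} → InLayer M₁ M₂ S 3 v ⇔
            (v ∉ S × ¬ InLayer M₁ M₂ S 1 v × ∃ λ u → InLayer M₁ M₂ S 2 u × Indep M₁ ((S - u) ∪ ⁅ v ⁆))
  layer₃⇔ {v} = mk⇔ split join
    where
    split : InLayer M₁ M₂ S 3 v →
            v ∉ S × ¬ InLayer M₁ M₂ S 1 v × ∃ λ u → InLayer M₁ M₂ S 2 u × Indep M₁ ((S - u) ∪ ⁅ v ⁆)
    split (w , shortest) with walk₃⁻ w
    ... | u , w₂ , v∉S , S-u+v∈I₁ =
      v∉S , (λ (w₁ , _) → shortest 1 (s≤s (s≤s z≤n)) w₁) , u , walk₂⇒layer₂ w₂ , S-u+v∈I₁

    join : v ∉ S × ¬ InLayer M₁ M₂ S 1 v × (∃ λ u → InLayer M₁ M₂ S 2 u × Indep M₁ ((S - u) ∪ ⁅ v ⁆)) →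
           InLayer M₁ M₂ S 3 v
    join (v∉S , not-layer₁ , u , (w₂ , _) , S-u+v∈I₁) =
      snoc w₂ (arc₁ (proj₁ (walk₂⁻ w₂)) v∉S S-u+v∈I₁) , λ
        { zero             _ → no-walk₀
        ; (suc zero)       _ w₁ → not-layer₁ (walk₁⇒layer₁ w₁)
        ; (suc (suc zero)) _ w₂′ → v∉S (proj₁ (walk₂⁻ w₂′))
        ; (suc (suc (suc _))) (s≤s (s≤s (s≤s ()))) }

data Which : Set where
  first second : Which

ask : ∀ {A} → Which → Subset n → (ℕ → OracleProg n A) → OracleProg n A
ask first  = ask₁
ask second = ask₂

answer : Which → (Subset n → ℕ) → (Subset n → ℕ) → Subset n → ℕ
answer first  r₁ r₂ = r₁
answer second r₁ r₂ = r₂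

select : ∀ {A} {P : Fin m → ℕ → Set} → Which → (Fin m → Subset n) → (∀ i a → Dec (P i a)) →
         (Subset m → OracleProg n A) → OracleProg n A
select {m = zero}  w Q P? k = k []
select {m = suc m} w Q P? k =
  ask w (Q zero) λ a → select w (Q ∘ suc) (P? ∘ suc) λ D → k (isYes (P? zero a) ∷ D)

module _ (r₁ r₂ : Subset n → ℕ) where

  run-ask : ∀ {A} w X (κ : ℕ → OracleProg n A) → run (ask w X κ) r₁ r₂ ≡ run (κ (answer w r₁ r₂ X)) r₁ r₂
  run-ask first  X κ = refl
  run-ask second X κ = refl

  queries-ask : ∀ {A} w X (κ : ℕ → OracleProg n A) →
                queries (ask w X κ) r₁ r₂ ≡ suc (queries (κ (answer w r₁ r₂ X)) r₁ r₂)
  queries-ask first  X κ = refl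
  queries-ask second X κ = refl

  selected : ∀ {P : Fin m → ℕ → Set} → Which → (Fin m → Subset n) → (∀ i a → Dec (P i a)) → Subset m
  selected w Q P? = tabulate λ i → isYes (P? i (answer w r₁ r₂ (Q i)))

  run-select : ∀ {A} {P : Fin m → ℕ → Set} w Q (P? : ∀ i a → Dec (P i a)) (k : Subset m → OracleProg n A) →
               run (select w Q P? k) r₁ r₂ ≡ run (k (selected w Q P?)) r₁ r₂
  run-select {m = zero}  w Q P? k = refl
  run-select {m = suc m} w Q P? k = trans (run-ask w (Q zero) _) (run-select w (Q ∘ suc) (P? ∘ suc) _)

  queries-select : ∀ {A} {P : Fin m → ℕ → Set} w Q (P? : ∀ i a → Dec (P i a)) (k : Subset m → OracleProg n A) →
                   queries (select w Q P? k) r₁ r₂ ≡ m + queries (k (selected w Q P?)) r₁ r₂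
  queries-select {m = zero}  w Q P? k = refl
  queries-select {m = suc m} w Q P? k =
    trans (queries-ask w (Q zero) _) (cong suc (queries-select w (Q ∘ suc) (P? ∘ suc) _))


  ∈-selected⇔ : ∀ {P : Fin m → ℕ → Set} w Q (P? : ∀ i a → Dec (P i a)) {i} →
                i ∈ selected w Q P? ⇔ P i (answer w r₁ r₂ (Q i))
  ∈-selected⇔ w Q P? = ∈-tabulate-isYes⇔ (λ i → P? i (answer w r₁ r₂ (Q i)))

module LayerAlgorithm (S : Subset n) where

  layer₁? : ∀ v a → Dec (v ∉ S × ∣ S ∣ < a)
  layer₁? v a = ¬? (v ∈? S) ×-dec (∣ S ∣ <? a)

  layer₂? : ∀ u a → Dec (u ∈ S × ∣ S - u ∣ < a)
  layer₂? u a = (u ∈? S) ×-dec (∣ S - u ∣ <? a)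

  layer₃? : (D₁ D₂ : Subset n) → ∀ v a → Dec (v ∉ S × v ∉ D₁ × ∣ S ─ D₂ ∣ < a)
  layer₃? D₁ D₂ v a = ¬? (v ∈? S) ×-dec (¬? (v ∈? D₁) ×-dec (∣ S ─ D₂ ∣ <? a))

  program : OracleProg n (Subset n × Subset n × Subset n)
  program =
    select first  (λ v → S ∪ ⁅ v ⁆)        layer₁?          λ D₁ →
    select second (λ u → (S - u) ∪ D₁)     layer₂?          λ D₂ →
    select first  (λ v → (S ─ D₂) ∪ ⁅ v ⁆) (layer₃? D₁ D₂) λ D₃ →
    ret (D₁ , D₂ , D₃)

  module Outcome (r₁ r₂ : Subset n → ℕ) where

    D₁ D₂ D₃ : Subset n
    D₁ = selected r₁ r₂ first  (λ v → S ∪ ⁅ v ⁆)        layer₁?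
    D₂ = selected r₁ r₂ second (λ u → (S - u) ∪ D₁)     layer₂?
    D₃ = selected r₁ r₂ first  (λ v → (S ─ D₂) ∪ ⁅ v ⁆) (layer₃? D₁ D₂)

    run-program : run program r₁ r₂ ≡ (D₁ , D₂ , D₃)
    run-program =
      trans (run-select r₁ r₂ first _ layer₁? _)
     (trans (run-select r₁ r₂ second _ layer₂? _)
            (run-select r₁ r₂ first _ (layer₃? D₁ D₂) _))

    queries-program : queries program r₁ r₂ ≡ 3 * n
    queries-program =
      trans (queries-select r₁ r₂ first _ layer₁? _) (cong (n +_)
     (trans (queries-select r₁ r₂ second _ layer₂? _) (cong (n +_)
            (queries-select r₁ r₂ first _ (layer₃? D₁ D₂) _))))

    ∈D₁⇔ : ∀ {v} → v ∈ D₁ ⇔ (v ∉ S × ∣ S ∣ < r₁ (S ∪ ⁅ v ⁆))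
    ∈D₁⇔ = ∈-selected⇔ r₁ r₂ first _ layer₁?

    ∈D₂⇔ : ∀ {u} → u ∈ D₂ ⇔ (u ∈ S × ∣ S - u ∣ < r₂ ((S - u) ∪ D₁))
    ∈D₂⇔ = ∈-selected⇔ r₁ r₂ second _ layer₂?

    ∈D₃⇔ : ∀ {v} → v ∈ D₃ ⇔ (v ∉ S × v ∉ D₁ × ∣ S ─ D₂ ∣ < r₁ ((S ─ D₂) ∪ ⁅ v ⁆))
    ∈D₃⇔ = ∈-selected⇔ r₁ r₂ first _ (layer₃? D₁ D₂)

module _ {M₁ M₂ : Matroid n} {S : Subset n} (S∈I₁ : Indep M₁ S) (S∈I₂ : Indep M₂ S)
         {r₁ r₂ : Subset n → ℕ} (rank₁ : IsRankOracle M₁ r₁) (rank₂ : IsRankOracle M₂ r₂) where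

  open LayerAlgorithm S
  open Outcome r₁ r₂
  open ExchangeGraph M₁ M₂ S

  ∈D₁⇔layer₁ : ∀ {v} → v ∈ D₁ ⇔ InLayer M₁ M₂ S 1 v
  ∈D₁⇔layer₁ {v} = mk⇔
    (λ v∈D₁ → from layer₁⇔ (to S+v-test (proj₂ (to ∈D₁⇔ v∈D₁))))
    (λ layer₁ → from ∈D₁⇔ (proj₁ (to layer₁⇔ layer₁) , from S+v-test (to layer₁⇔ layer₁)))
    where
    S+v-test : ∣ S ∣ < r₁ (S ∪ ⁅ v ⁆) ⇔ (v ∉ S × Indep M₁ (S ∪ ⁅ v ⁆))
    S+v-test = ∣I∣<rank[I∪⁅x⁆]⇔indep M₁ S∈I₁ (rank₁ (S ∪ ⁅ v ⁆))

  ∈D₂⇔layer₂ : ∀ {u} → u ∈ D₂ ⇔ InLayer M₁ M₂ S 2 u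
  ∈D₂⇔layer₂ {u} = mk⇔
    (λ u∈D₂ →
      let (u∈S , gap) = to ∈D₂⇔ u∈D₂
          (v , v∈D₁ , _ , S-u+v∈I₂) = to S-u-gap gap
      in from layer₂⇔ (u∈S , v , to ∈D₁⇔layer₁ v∈D₁ , S-u+v∈I₂))
    (λ layer₂ →
      let (u∈S , v , layer₁ , S-u+v∈I₂) = to layer₂⇔ layer₂
          v∉S-u = λ v∈S-u → proj₁ (to layer₁⇔ layer₁) (p─q⊆p S ⁅ u ⁆ v∈S-u)
      in from ∈D₂⇔ (u∈S , from S-u-gap (v , from ∈D₁⇔layer₁ layer₁ , v∉S-u , S-u+v∈I₂)))
    where
    S-u-gap : ∣ S - u ∣ < r₂ ((S - u) ∪ D₁) ⇔
              (∃ λ v → v ∈ D₁ × v ∉ S - u × Indep M₂ ((S - u) ∪ ⁅ v ⁆))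
    S-u-gap = ∣I∣<rank⇔augmentable M₂ (indep-↓ M₂ (p─q⊆p S ⁅ u ⁆) S∈I₂) (rank₂ _)

  ∈D₃⇔layer₃ : ∀ {v} → v ∈ D₃ ⇔ InLayer M₁ M₂ S 3 v
  ∈D₃⇔layer₃ {v} = mk⇔
    (λ v∈D₃ →
      let (v∉S , v∉D₁ , gap) = to ∈D₃⇔ v∈D₃
          (u , u∈D₂ , S-u+v∈I₁) = to (swap v∉S v∉D₁) (proj₂ (to S─D₂+v-test gap))
      in from layer₃⇔ (v∉S , v∉D₁ ∘ from ∈D₁⇔layer₁ , u , to ∈D₂⇔layer₂ u∈D₂ , S-u+v∈I₁))
    (λ layer₃ →
      let (v∉S , not-layer₁ , u , layer₂ , S-u+v∈I₁) = to layer₃⇔ layer₃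
          v∉D₁ = not-layer₁ ∘ to ∈D₁⇔layer₁
          S─D₂+v∈I₁ = from (swap v∉S v∉D₁) (u , from ∈D₂⇔layer₂ layer₂ , S-u+v∈I₁)
      in from ∈D₃⇔ (v∉S , v∉D₁ , from S─D₂+v-test (v∉S ∘ p─q⊆p S D₂ , S─D₂+v∈I₁)))
    where
    S─D₂+v-test : ∣ S ─ D₂ ∣ < r₁ ((S ─ D₂) ∪ ⁅ v ⁆) ⇔
                  (v ∉ S ─ D₂ × Indep M₁ ((S ─ D₂) ∪ ⁅ v ⁆))
    S─D₂+v-test = ∣I∣<rank[I∪⁅x⁆]⇔indep M₁ (indep-↓ M₁ (p─q⊆p S D₂) S∈I₁) (rank₁ _)

    swap : v ∉ S → v ∉ D₁ →
           Indep M₁ ((S ─ D₂) ∪ ⁅ v ⁆) ⇔ (∃ λ u → u ∈ D₂ × Indep M₁ ((S - u) ∪ ⁅ v ⁆))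
    swap v∉S v∉D₁ = indep[S─D∪⁅v⁆]⇔swap∈D M₁ S∈I₁ v∉S
      (λ S+v∈I₁ → v∉D₁ (from ∈D₁⇔layer₁ (from layer₁⇔ (v∉S , S+v∈I₁))))

  correct-layers : CorrectLayers M₁ M₂ S (D₁ , D₂ , D₃)
  correct-layers = represents ∈D₁⇔layer₁ , represents ∈D₂⇔layer₂ , represents ∈D₃⇔layer₃
    where
    represents : ∀ {i D} → (∀ {v} → v ∈ D ⇔ InLayer M₁ M₂ S i v) → Represents M₁ M₂ S i D
    represents D⇔layer v = to D⇔layer , from D⇔layer

lemma17 : Σ ℕ λ c → ∀ (n : ℕ) (S : Subset n) →
    Σ (OracleProg n (Subset n × Subset n × Subset n)) λ P →
    ∀ (M₁ M₂ : Matroid n) → Indep M₁ S → Indep M₂ S →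
    ∀ (r₁ r₂ : Subset n → ℕ) → IsRankOracle M₁ r₁ → IsRankOracle M₂ r₂ →
    queries P r₁ r₂ ≤ c * suc n
    × CorrectLayers M₁ M₂ S (run P r₁ r₂)
lemma17 = 3 , λ n S → program S , λ M₁ M₂ S∈I₁ S∈I₂ r₁ r₂ rank₁ rank₂ →
    subst (_≤ 3 * suc n) (sym (queries-program S r₁ r₂)) (*-monoʳ-≤ 3 (n≤1+n n))
  , subst (CorrectLayers M₁ M₂ S) (sym (run-program S r₁ r₂)) (correct-layers S∈I₁ S∈I₂ rank₁ rank₂)
  where open LayerAlgorithm using (program; module Outcome)
        open Outcome using (run-program; queries-program)
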